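{- Let $k\geq 3$, $n_1,\dots,n_k\geq 2$ and $r\in\{1,\dots,k\}$. Let $V=U_1\sqcup\cdots\sqcup U_k$ with $|U_i|=n_i$, let $K_{n_1,\dots,n_k}$ be the complete $k$-partite graph on $V$ with parts $U_1,\dots,U_k$, and let $CS^r_{n_1,\dots,n_k}$ be the clique-star on $V$ with cliques $U_1,\dots,U_k$ and center clique $U_r$. Then $K_{n_1,\dots,n_k}$ and $CS^r_{n_1,\dots,n_k}$ are not locally equivalent, i.e. $\mathcal{O}(K_{n_1,\dots,n_k})\cap\mathcal{O}(CS^r_{n_1,\dots,n_k})=\emptyset$.
   Context: Local complement $c_v(G)$: replace the subgraph induced on the neighbourhood of vertex $v$ by its complement, leaving all other edges unchanged. Two graphs on the same labeled vertex set are locally equivalent if one is obtained from the other by a finite sequence of local complements; $\mathcal{O}(G)$ denotes the set of graphs locally equivalent to $G$. Complete $k$-partite graph: two vertices adjacent iff in different parts. Clique-star $CS^r$: each $U_i$ is a clique, all vertices of $U_r$ are adjacent to all vertices of every $U_i$ ($i\neq r$), and there are no edges between $U_i$ and $U_j$ for distinct $i,j\neq r$. -}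

module Defs where

open import Data.Nat using (ℕ)
open import Data.Fin using (Fin)
open import Data.Fin.Properties using () renaming (_≟_ to _≟F_)
open import Data.Bool using (Bool; true; false; not; _∧_; _∨_; if_then_else_)
open import Data.Product using (Σ; _,_; proj₁; ∃)
open import Data.Product.Properties using (≡-dec)
open import Data.List using (List; foldl)
open import Relation.Nullary.Decidable using (⌊_⌋)
open import Relation.Binary.PropositionalEquality using (_≡_)

Graph : Set → Set
Graph V = V → V → Bool

-- Labeled vertex set V = U₁ ⊔ ⋯ ⊔ U_k with |U_i| = n i : vertex (i , a), a : Fin (n i).
Vtx : (k : ℕ) → (Fin k → ℕ) → Set
Vtx k n = Σ (Fin k) (λ i → Fin (n i))

_==V_ : ∀ {k n} → Vtx k n → Vtx k n → Bool
_==V_ {k} {n} x y = ⌊ ≡-dec _≟F_ _≟F_ x y ⌋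

_==F_ : ∀ {k} → Fin k → Fin k → Bool
i ==F j = ⌊ i ≟F j ⌋

completeMultipartite : (k : ℕ) (n : Fin k → ℕ) → Graph (Vtx k n)
completeMultipartite k n (i , _) (j , _) = not (i ==F j)

cliqueStar : (k : ℕ) (n : Fin k → ℕ) (r : Fin k) → Graph (Vtx k n)
cliqueStar k n r x@(i , _) y@(j , _) =
  if i ==F j then not (x ==V y) else ((i ==F r) ∨ (j ==F r))

localComplement : ∀ {k n} → Graph (Vtx k n) → Vtx k n → Graph (Vtx k n)
localComplement G v x y =
  if G v x ∧ G v y ∧ not (x ==V y) then not (G x y) else G x y

applyLCs : ∀ {k n} → Graph (Vtx k n) → List (Vtx k n) → Graph (Vtx k n)
applyLCs G vs = foldl localComplement G vs

LocallyEquivalent : ∀ {k n} → Graph (Vtx k n) → Graph (Vtx k n) → Set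
LocallyEquivalent G H = ∃ λ vs → ∀ x y → applyLCs G vs x y ≡ H x y

-- Pick one vertex x i in every part U i. Over GF(2), "the rows of x 1, …, x k in the
-- adjacency matrix between X = {x i} and its complement are linearly dependent" is
-- invariant under local complementation. Complementing at v adds G(v, x i) times the row
-- of v to the row of x i, so a vanishing combination Σ s i (row of x i) changes by
-- c (row of v) with c = Σ s i G(v, x i). If v lies outside X, c is an entry of the
-- combination itself and is 0; if v = x j, toggling s j compensates, as the row of x j
-- does not change.
-- In K the row of x j is the all-ones vector minus the indicator of U j, in CS it is the
-- indicator of U j ∪ U r. The all-ones combination therefore vanishes for K exactly when
-- k is odd and for CS exactly when k is even, and in the other case no nonzero
-- combination vanishes. So the invariant separates K from CS.
module Submission where

open import Defs
open import Algebra.Bundles using (CommutativeRing)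
open import Axiom.UniquenessOfIdentityProofs using (module Decidable⇒UIP)
open import Data.Bool using (Bool; true; false; not; _∧_; _∨_; _xor_; if_then_else_)
open import Data.Bool.Properties
  using ( xor-∧-commutativeRing; xor-identityʳ; xor-same; ∧-identityʳ; ∧-zeroʳ
        ; ∧-distribʳ-xor; ∨-zeroʳ; ∨-identityʳ; if-cong)
open import Data.Bool.Solver using (module xor-∧-Solver)
open import Data.Fin using (Fin; zero; suc)
open import Data.Fin.Properties using (any?) renaming (_≟_ to _≟F_)
open import Data.List using ([]; _∷_)
open import Data.Nat using (ℕ; _≤_; s≤s)
open import Data.Product using (_,_; ∃; _×_; proj₁)
open import Data.Product.Properties using (≡-dec; ,-injectiveʳ-UIP)
open import Data.Sum using (inj₁; inj₂)
open import Function using (_∘_; _⇔_; mk⇔; Equivalence)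
open import Function.Construct.Composition using (_⇔-∘_)
open import Function.Construct.Identity using (⇔-id)
open import Relation.Binary.Definitions using (DecidableEquality)
open import Relation.Binary.PropositionalEquality
open import Relation.Nullary using (¬_; yes; no; contradiction)
open import Relation.Nullary.Decidable using (⌊_⌋; isYes≗does; dec-true; dec-false; toSum)

open CommutativeRing xor-∧-commutativeRing using (semiring)
open import Algebra.Properties.Semiring.Sum semiring
  using (sum; sum-cong-≗; sum-replicate-zero; ∑-distrib-+; *-distribˡ-sum)

module _ {A : Set} (_≟_ : DecidableEquality A) where

  ⌊≟⌋-refl : ∀ a → ⌊ a ≟ a ⌋ ≡ true
  ⌊≟⌋-refl a = trans (isYes≗does (a ≟ a)) (dec-true (a ≟ a) refl)

  ⌊≟⌋-≢ : ∀ {a b} → a ≢ b → ⌊ a ≟ b ⌋ ≡ false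
  ⌊≟⌋-≢ {a} {b} a≢b = trans (isYes≗does (a ≟ b)) (dec-false (a ≟ b) a≢b)

  ⌊≟⌋-sym : ∀ a b → ⌊ a ≟ b ⌋ ≡ ⌊ b ≟ a ⌋
  ⌊≟⌋-sym a b with a ≟ b
  ... | yes refl = sym (⌊≟⌋-refl a)
  ... | no a≢b   = sym (⌊≟⌋-≢ (a≢b ∘ sym))

_≟V_ : ∀ {k n} → DecidableEquality (Vtx k n)
_≟V_ = ≡-dec _≟F_ _≟F_

true≢false : true ≢ false
true≢false ()

∧≡true⇒ : ∀ {a b} → a ∧ b ≡ true → a ≡ true × b ≡ true
∧≡true⇒ {true} {true} _ = refl , refl

xor≡false⇒≡ : ∀ {a b} → a xor b ≡ false → a ≡ b
xor≡false⇒≡ {true}  {true}  _ = refl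
xor≡false⇒≡ {false} {false} _ = refl

if-not≡xor : ∀ c b → (if c then not b else b) ≡ c xor b
if-not≡xor true  b = refl
if-not≡xor false b = refl

∧-not≡xor-∧ : ∀ a b → a ∧ not b ≡ a xor (b ∧ a)
∧-not≡xor-∧ a true  = trans (∧-zeroʳ a) (sym (xor-same a))
∧-not≡xor-∧ a false = trans (∧-identityʳ a) (sym (xor-identityʳ a))

-- Sums over GF(2)

parity : ℕ → Bool
parity m = sum {m} (λ _ → true)

sum-constant : ∀ {m} {s : Fin m → Bool} {c} → (∀ i → s i ≡ c) → sum s ≡ c ∧ parity m
sum-constant {m} {s} {c} s≡c = begin
  sum s                      ≡⟨ sum-cong-≗ {m} (λ i → trans (s≡c i) (sym (∧-identityʳ c))) ⟩
  sum {m} (λ _ → c ∧ true)   ≡⟨ *-distribˡ-sum {m} c (λ _ → true) ⟨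
  c ∧ parity m               ∎
  where open ≡-Reasoning

sum-indicator : ∀ {m} (j : Fin m) (f : Fin m → Bool) → sum (λ i → (i ==F j) ∧ f i) ≡ f j
sum-indicator {ℕ.suc m} zero f =
  trans (cong (f zero xor_) (sum-replicate-zero m)) (xor-identityʳ (f zero))
sum-indicator (suc j) f =
  trans (sum-cong-≗ (λ i → cong (_∧ f (suc i)) (suc==Fsuc i))) (sum-indicator j (f ∘ suc))
  where
  suc==Fsuc : ∀ i → (Fin.suc i ==F suc j) ≡ (i ==F j)
  suc==Fsuc i = trans (isYes≗does (suc i ≟F suc j)) (sym (isYes≗does (i ≟F j)))

sum≡true⇒∃ : ∀ {m} (f : Fin m → Bool) → sum f ≡ true → ∃ λ i → f i ≡ true
sum≡true⇒∃ {ℕ.suc m} f sum≡true with f zero in f0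
... | true  = zero , f0
... | false with sum≡true⇒∃ (f ∘ suc) sum≡true
...   | i , fi = suc i , fi

-- Local complementation

IsSymmetric : ∀ {V} → Graph V → Set
IsSymmetric G = ∀ a b → G a b ≡ G b a

IsLoopless : ∀ {V} → Graph V → Set
IsLoopless G = ∀ a → G a a ≡ false

module _ {k : ℕ} {n : Fin k → ℕ} where

  localComplement-xor : ∀ (G : Graph (Vtx k n)) v a b →
    localComplement G v a b ≡ (G v a ∧ G v b ∧ not (a ==V b)) xor G a b
  localComplement-xor G v a b = if-not≡xor (G v a ∧ G v b ∧ not (a ==V b)) (G a b)

  localComplement-centre : ∀ {G : Graph (Vtx k n)} → IsLoopless G →
    ∀ v a → localComplement G v v a ≡ G v a
  localComplement-centre {G} loopless v a = trans (localComplement-xor G v v a)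
    (cong (λ c → (c ∧ G v a ∧ not (v ==V a)) xor G v a) (loopless v))

  localComplement-loopless : ∀ {G : Graph (Vtx k n)} → IsLoopless G →
    ∀ v → IsLoopless (localComplement G v)
  localComplement-loopless {G} loopless v a = begin
    localComplement G v a a
      ≡⟨ localComplement-xor G v a a ⟩
    (G v a ∧ G v a ∧ not (a ==V a)) xor G a a
      ≡⟨ cong (λ c → (G v a ∧ G v a ∧ not c) xor G a a) (⌊≟⌋-refl _≟V_ a) ⟩
    (G v a ∧ G v a ∧ false) xor G a a
      ≡⟨ cong (λ c → (G v a ∧ c) xor G a a) (∧-zeroʳ (G v a)) ⟩
    (G v a ∧ false) xor G a a
      ≡⟨ cong (_xor G a a) (∧-zeroʳ (G v a)) ⟩
    G a a
      ≡⟨ loopless a ⟩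
    false
      ∎
    where open ≡-Reasoning

  localComplement-symmetric : ∀ {G : Graph (Vtx k n)} → IsSymmetric G →
    ∀ v → IsSymmetric (localComplement G v)
  localComplement-symmetric {G} symmetric v a b = begin
    localComplement G v a b
      ≡⟨ localComplement-xor G v a b ⟩
    (G v a ∧ G v b ∧ not (a ==V b)) xor G a b
      ≡⟨ cong₂ (λ c d → (G v a ∧ G v b ∧ not c) xor d) (⌊≟⌋-sym _≟V_ a b) (symmetric a b) ⟩
    (G v a ∧ G v b ∧ not (b ==V a)) xor G b a
      ≡⟨ cong (_xor G b a) (∧-swap (G v a) (G v b) _) ⟩
    (G v b ∧ G v a ∧ not (b ==V a)) xor G b a
      ≡⟨ localComplement-xor G v b a ⟨
    localComplement G v b a
      ∎
    where
    open ≡-Reasoning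
    ∧-swap : ∀ p q r → p ∧ q ∧ r ≡ q ∧ p ∧ r
    ∧-swap = solve 3 (λ p q r → p :* (q :* r) := q :* (p :* r)) refl
      where open xor-∧-Solver

  localComplement-involutive : ∀ {G : Graph (Vtx k n)} → IsLoopless G →
    ∀ v a b → localComplement (localComplement G v) v a b ≡ G a b
  localComplement-involutive {G} loopless v a b = begin
    localComplement lc v a b
      ≡⟨ localComplement-xor lc v a b ⟩
    (lc v a ∧ lc v b ∧ not (a ==V b)) xor lc a b
      ≡⟨ cong₂ (λ p q → (p ∧ q ∧ not (a ==V b)) xor lc a b)
               (localComplement-centre {G = G} loopless v a)
               (localComplement-centre {G = G} loopless v b) ⟩
    c xor lc a b
      ≡⟨ cong (c xor_) (localComplement-xor G v a b) ⟩
    c xor (c xor G a b)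
      ≡⟨ xor-cancel c (G a b) ⟩
    G a b
      ∎
    where
    open ≡-Reasoning
    lc = localComplement G v
    c = G v a ∧ G v b ∧ not (a ==V b)
    xor-cancel : ∀ p q → p xor (p xor q) ≡ q
    xor-cancel = solve 2 (λ p q → p :+ (p :+ q) := q) refl
      where open xor-∧-Solver

-- Invariance of the cut-rank deficiency

-- RowsDependent G: the rows x i of the GF(2) adjacency matrix between {x i} and its
-- complement are linearly dependent, i.e. (for injective x) the cut-rank of {x i} is < m.
module CutRank {k : ℕ} {n : Fin k → ℕ} {m : ℕ} (x : Fin m → Vtx k n) where

  Outside : Vtx k n → Set
  Outside y = ∀ i → x i ≢ y

  rowSum : Graph (Vtx k n) → (Fin m → Bool) → Vtx k n → Bool
  rowSum G s y = sum λ i → s i ∧ G (x i) y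

  Kernel : Graph (Vtx k n) → (Fin m → Bool) → Set
  Kernel G s = ∀ y → Outside y → rowSum G s y ≡ false

  RowsDependent : Graph (Vtx k n) → Set
  RowsDependent G = ∃ λ s → (∃ λ i → s i ≡ true) × Kernel G s

  rowsDependent-cong : ∀ {G H} → (∀ a b → G a b ≡ H a b) → RowsDependent G → RowsDependent H
  rowsDependent-cong G≗H (s , nonzero , kernel) = s , nonzero , λ y out →
    trans (sum-cong-≗ {m} (λ i → cong (s i ∧_) (sym (G≗H (x i) y)))) (kernel y out)

  rowSum-localComplement : ∀ G v s y → Outside y →
    rowSum (localComplement G v) s y ≡ (G v y ∧ sum (λ i → s i ∧ G v (x i))) xor rowSum G s y
  rowSum-localComplement G v s y out = begin
    sum (λ i → s i ∧ localComplement G v (x i) y)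
      ≡⟨ sum-cong-≗ {m} term ⟩
    sum (λ i → (G v y ∧ (s i ∧ G v (x i))) xor (s i ∧ G (x i) y))
      ≡⟨ ∑-distrib-+ {m} (λ i → G v y ∧ (s i ∧ G v (x i))) _ ⟩
    sum (λ i → G v y ∧ (s i ∧ G v (x i))) xor rowSum G s y
      ≡⟨ cong (_xor rowSum G s y) (*-distribˡ-sum {m} (G v y) _) ⟨
    (G v y ∧ sum (λ i → s i ∧ G v (x i))) xor rowSum G s y
      ∎
    where
    open ≡-Reasoning
    distribute : ∀ p q r t → p ∧ ((q ∧ r ∧ true) xor t) ≡ (r ∧ (p ∧ q)) xor (p ∧ t)
    distribute = solve 4 (λ p q r t → p :* ((q :* (r :* con true)) :+ t) := (r :* (p :* q)) :+ (p :* t)) refl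
      where open xor-∧-Solver
    term : ∀ i → s i ∧ localComplement G v (x i) y ≡ (G v y ∧ (s i ∧ G v (x i))) xor (s i ∧ G (x i) y)
    term i = begin
      s i ∧ localComplement G v (x i) y
        ≡⟨ cong (s i ∧_) (localComplement-xor G v (x i) y) ⟩
      s i ∧ ((G v (x i) ∧ G v y ∧ not (x i ==V y)) xor G (x i) y)
        ≡⟨ cong (λ c → s i ∧ ((G v (x i) ∧ G v y ∧ not c) xor G (x i) y)) (⌊≟⌋-≢ _≟V_ (out i)) ⟩
      s i ∧ ((G v (x i) ∧ G v y ∧ true) xor G (x i) y)
        ≡⟨ distribute (s i) (G v (x i)) (G v y) (G (x i) y) ⟩
      (G v y ∧ (s i ∧ G v (x i))) xor (s i ∧ G (x i) y)
        ∎

  kernel-localComplement : ∀ {G v s} → sum (λ i → s i ∧ G v (x i)) ≡ false →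
    Kernel G s → Kernel (localComplement G v) s
  kernel-localComplement {G} {v} {s} vanishes kernel y out = begin
    rowSum (localComplement G v) s y
      ≡⟨ rowSum-localComplement G v s y out ⟩
    (G v y ∧ sum (λ i → s i ∧ G v (x i))) xor rowSum G s y
      ≡⟨ cong₂ (λ c d → (G v y ∧ c) xor d) vanishes (kernel y out) ⟩
    (G v y ∧ false) xor false
      ≡⟨ cong (_xor false) (∧-zeroʳ (G v y)) ⟩
    false
      ∎
    where open ≡-Reasoning

  rowsDependent-localComplement-outside : ∀ {G v} → IsSymmetric G → Outside v →
    RowsDependent G → RowsDependent (localComplement G v)
  rowsDependent-localComplement-outside {G} {v} symmetric out (s , nonzero , kernel) =
    s , nonzero , kernel-localComplement {G} {v} vanishes kernel
    where
    vanishes : sum (λ i → s i ∧ G v (x i)) ≡ false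
    vanishes = trans (sum-cong-≗ {m} (λ i → cong (s i ∧_) (symmetric v (x i)))) (kernel v out)

  -- If the coefficient does not vanish, adding the row of x j itself to the combination
  -- cancels the change, since localComplement G (x j) keeps the row of x j.
  rowsDependent-localComplement-row : ∀ {G} → IsLoopless G → ∀ j →
    RowsDependent G → RowsDependent (localComplement G (x j))
  rowsDependent-localComplement-row {G} loopless j (s , nonzero , kernel)
    with sum (λ i → s i ∧ G (x j) (x i)) in coefficient
  ... | false = s , nonzero , kernel-localComplement {G} {x j} coefficient kernel
  ... | true  = s′ , nonzero′ , kernel′
    where
    lc = localComplement G (x j)

    s′ : Fin m → Bool
    s′ i = s i xor (i ==F j)

    nonzero′ : ∃ λ i → s′ i ≡ true
    nonzero′ with sum≡true⇒∃ (λ i → s i ∧ G (x j) (x i)) coefficient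
    ... | i , hit with ∧≡true⇒ {s i} hit | i ≟F j
    ...   | sᵢ , _    | no i≢j   = i , cong₂ _xor_ sᵢ (⌊≟⌋-≢ _≟F_ i≢j)
    ...   | _  , edge | yes refl = contradiction (trans (sym edge) (loopless (x i))) true≢false

    kernel′ : Kernel lc s′
    kernel′ y out = begin
      rowSum lc s′ y
        ≡⟨ sum-cong-≗ {m} (λ i → ∧-distribʳ-xor _ (s i) (i ==F j)) ⟩
      sum (λ i → (s i ∧ lc (x i) y) xor ((i ==F j) ∧ lc (x i) y))
        ≡⟨ ∑-distrib-+ {m} (λ i → s i ∧ lc (x i) y) _ ⟩
      rowSum lc s y xor sum (λ i → (i ==F j) ∧ lc (x i) y)
        ≡⟨ cong₂ _xor_ (rowSum-localComplement G (x j) s y out) (sum-indicator j (λ i → lc (x i) y)) ⟩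
      ((G (x j) y ∧ sum (λ i → s i ∧ G (x j) (x i))) xor rowSum G s y) xor lc (x j) y
        ≡⟨ cong₂ (λ c d → ((G (x j) y ∧ c) xor d) xor lc (x j) y) coefficient (kernel y out) ⟩
      ((G (x j) y ∧ true) xor false) xor lc (x j) y
        ≡⟨ cong (((G (x j) y ∧ true) xor false) xor_) (localComplement-centre {G = G} loopless (x j) y) ⟩
      ((G (x j) y ∧ true) xor false) xor G (x j) y
        ≡⟨ cancel (G (x j) y) ⟩
      false
        ∎
      where
      open ≡-Reasoning
      cancel : ∀ p → ((p ∧ true) xor false) xor p ≡ false
      cancel = solve 1 (λ p → ((p :* con true) :+ con false) :+ p := con false) refl
        where open xor-∧-Solver

  rowsDependent-localComplement : ∀ {G} → IsSymmetric G → IsLoopless G → ∀ v →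
    RowsDependent G → RowsDependent (localComplement G v)
  rowsDependent-localComplement {G} symmetric loopless v with any? (λ j → x j ≟V v)
  ... | yes (j , refl) = rowsDependent-localComplement-row {G} loopless j
  ... | no ∄j          = rowsDependent-localComplement-outside {G} symmetric (λ i xᵢ≡v → ∄j (i , xᵢ≡v))

  rowsDependent-localComplement-⇔ : ∀ {G} → IsSymmetric G → IsLoopless G → ∀ v →
    RowsDependent G ⇔ RowsDependent (localComplement G v)
  rowsDependent-localComplement-⇔ {G} symmetric loopless v = mk⇔
    (rowsDependent-localComplement symmetric loopless v)
    (rowsDependent-cong (localComplement-involutive {G = G} loopless v)
      ∘ rowsDependent-localComplement (localComplement-symmetric {G = G} symmetric v)
                                      (localComplement-loopless {G = G} loopless v) v)

  rowsDependent-applyLCs : ∀ {G} → IsSymmetric G → IsLoopless G → ∀ vs →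
    RowsDependent G ⇔ RowsDependent (applyLCs G vs)
  rowsDependent-applyLCs symmetric loopless []       = ⇔-id _
  rowsDependent-applyLCs {G} symmetric loopless (v ∷ vs) =
    rowsDependent-applyLCs (localComplement-symmetric {G = G} symmetric v)
                           (localComplement-loopless {G = G} loopless v) vs
      ⇔-∘ rowsDependent-localComplement-⇔ symmetric loopless v

-- The complete multipartite graph and the clique-star

first second : ∀ {m} → 2 ≤ m → Fin m
first  (s≤s (s≤s _)) = zero
second (s≤s (s≤s _)) = suc zero

second≢first : ∀ {m} (2≤m : 2 ≤ m) → second 2≤m ≢ first 2≤m
second≢first (s≤s (s≤s _)) ()

module MultipartiteVersusCliqueStar (k : ℕ) (n : Fin k → ℕ) (2≤n : ∀ i → 2 ≤ n i) (r : Fin k) where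

  representative : Fin k → Vtx k n
  representative i = i , first (2≤n i)

  open CutRank representative public

  K CS : Graph (Vtx k n)
  K  = completeMultipartite k n
  CS = cliqueStar k n r

  other : Fin k → Vtx k n
  other j = j , second (2≤n j)

  other-outside : ∀ j → Outside (other j)
  other-outside j i rep≡other with cong proj₁ rep≡other
  ... | refl = second≢first (2≤n j)
                 (sym (,-injectiveʳ-UIP (Decidable⇒UIP.≡-irrelevant _≟F_) rep≡other))

  multipartite-symmetric : IsSymmetric K
  multipartite-symmetric (i , _) (j , _) = cong not (⌊≟⌋-sym _≟F_ i j)

  multipartite-loopless : IsLoopless K
  multipartite-loopless (i , _) = cong not (⌊≟⌋-refl _≟F_ i)

  rowSum-multipartite : ∀ s j b → rowSum K s (j , b) ≡ sum s xor s j
  rowSum-multipartite s j b = begin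
    sum (λ i → s i ∧ not (i ==F j))
      ≡⟨ sum-cong-≗ {k} (λ i → ∧-not≡xor-∧ (s i) (i ==F j)) ⟩
    sum (λ i → s i xor ((i ==F j) ∧ s i))
      ≡⟨ ∑-distrib-+ {k} s _ ⟩
    sum s xor sum (λ i → (i ==F j) ∧ s i)
      ≡⟨ cong (sum s xor_) (sum-indicator j s) ⟩
    sum s xor s j
      ∎
    where open ≡-Reasoning

  cliqueStar-centre : ∀ {i b} → Outside (r , b) → CS (representative i) (r , b) ≡ true
  -- Splitting on toSum (i ≟F r) rather than on i ≟F r stops the with from also abstracting
  -- the occurrence of i ≟F r inside the vertex comparison ==V.
  cliqueStar-centre {i} out with toSum (i ≟F r)
  ... | inj₁ refl = begin
    CS (representative r) (r , _)        ≡⟨ if-cong (⌊≟⌋-refl _≟F_ r) ⟩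
    not (representative r ==V (r , _))   ≡⟨ cong not (⌊≟⌋-≢ _≟V_ (out r)) ⟩
    true                                 ∎
    where open ≡-Reasoning
  ... | inj₂ i≢r  = begin
    CS (representative i) (r , _)        ≡⟨ if-cong (⌊≟⌋-≢ _≟F_ i≢r) ⟩
    (i ==F r) ∨ (r ==F r)                ≡⟨ cong ((i ==F r) ∨_) (⌊≟⌋-refl _≟F_ r) ⟩
    (i ==F r) ∨ true                     ≡⟨ ∨-zeroʳ (i ==F r) ⟩
    true                                 ∎
    where open ≡-Reasoning

  cliqueStar-leaf : ∀ {i j b} → j ≢ r → Outside (j , b) →
    CS (representative i) (j , b) ≡ (i ==F j) xor (i ==F r)
  cliqueStar-leaf {i} {j} j≢r out with toSum (i ≟F j)
  ... | inj₁ refl = begin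
    CS (representative i) (i , _)        ≡⟨ if-cong (⌊≟⌋-refl _≟F_ i) ⟩
    not (representative i ==V (i , _))   ≡⟨ cong not (⌊≟⌋-≢ _≟V_ (out i)) ⟩
    true xor false                       ≡⟨ cong₂ _xor_ (⌊≟⌋-refl _≟F_ i) (⌊≟⌋-≢ _≟F_ j≢r) ⟨
    (i ==F i) xor (i ==F r)              ∎
    where open ≡-Reasoning
  ... | inj₂ i≢j  = begin
    CS (representative i) (j , _)        ≡⟨ if-cong (⌊≟⌋-≢ _≟F_ i≢j) ⟩
    (i ==F r) ∨ (j ==F r)                ≡⟨ cong ((i ==F r) ∨_) (⌊≟⌋-≢ _≟F_ j≢r) ⟩
    (i ==F r) ∨ false                    ≡⟨ ∨-identityʳ (i ==F r) ⟩
    false xor (i ==F r)                  ≡⟨ cong (_xor (i ==F r)) (⌊≟⌋-≢ _≟F_ i≢j) ⟨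
    (i ==F j) xor (i ==F r)              ∎
    where open ≡-Reasoning

  rowSum-cliqueStar-centre : ∀ s {b} → Outside (r , b) → rowSum CS s (r , b) ≡ sum s
  rowSum-cliqueStar-centre s out =
    sum-cong-≗ {k} (λ i → trans (cong (s i ∧_) (cliqueStar-centre {i} out)) (∧-identityʳ (s i)))

  rowSum-cliqueStar-leaf : ∀ s {j b} → j ≢ r → Outside (j , b) → rowSum CS s (j , b) ≡ s j xor s r
  rowSum-cliqueStar-leaf s {j} j≢r out = begin
    sum (λ i → s i ∧ CS (representative i) (j , _))
      ≡⟨ sum-cong-≗ {k} (λ i → cong (s i ∧_) (cliqueStar-leaf {i} j≢r out)) ⟩
    sum (λ i → s i ∧ ((i ==F j) xor (i ==F r)))
      ≡⟨ sum-cong-≗ {k} (λ i → distribute (s i) (i ==F j) (i ==F r)) ⟩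
    sum (λ i → ((i ==F j) ∧ s i) xor ((i ==F r) ∧ s i))
      ≡⟨ ∑-distrib-+ {k} (λ i → (i ==F j) ∧ s i) _ ⟩
    sum (λ i → (i ==F j) ∧ s i) xor sum (λ i → (i ==F r) ∧ s i)
      ≡⟨ cong₂ _xor_ (sum-indicator j s) (sum-indicator r s) ⟩
    s j xor s r
      ∎
    where
    open ≡-Reasoning
    distribute : ∀ a c d → a ∧ (c xor d) ≡ (c ∧ a) xor (d ∧ a)
    distribute = solve 3 (λ a c d → a :* (c :+ d) := (c :* a) :+ (d :* a)) refl
      where open xor-∧-Solver

  multipartite-dependent-odd : parity k ≡ true → RowsDependent K
  multipartite-dependent-odd odd = (λ _ → true) , (r , refl) ,
    λ { (j , b) _ → trans (rowSum-multipartite _ j b) (cong (_xor true) odd) }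

  cliqueStar-dependent-even : parity k ≡ false → RowsDependent CS
  cliqueStar-dependent-even even = (λ _ → true) , (r , refl) , kernel
    where
    kernel : Kernel CS (λ _ → true)
    kernel (j , b) out with toSum (j ≟F r)
    ... | inj₁ refl = trans (rowSum-cliqueStar-centre _ out) even
    ... | inj₂ j≢r  = rowSum-cliqueStar-leaf _ j≢r out

  multipartite-independent-even : parity k ≡ false → ¬ RowsDependent K
  multipartite-independent-even even (s , (i , sᵢ) , kernel) = true≢false (begin
    true               ≡⟨ sᵢ ⟨
    s i                ≡⟨ s≡sum i ⟩
    sum s              ≡⟨ sum-constant s≡sum ⟩
    sum s ∧ parity k   ≡⟨ cong (sum s ∧_) even ⟩
    sum s ∧ false      ≡⟨ ∧-zeroʳ (sum s) ⟩
    false              ∎)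
    where
    open ≡-Reasoning
    s≡sum : ∀ j → s j ≡ sum s
    s≡sum j = sym (xor≡false⇒≡ (trans (sym (rowSum-multipartite s j (second (2≤n j))))
                                      (kernel (other j) (other-outside j))))

  cliqueStar-independent-odd : parity k ≡ true → ¬ RowsDependent CS
  cliqueStar-independent-odd odd (s , (i , sᵢ) , kernel) = true≢false (begin
    true                    ≡⟨ sᵢ ⟨
    s i                     ≡⟨ s≡sᵣ i ⟩
    s r                     ≡⟨ ∧-identityʳ (s r) ⟨
    s r ∧ true              ≡⟨ cong (s r ∧_) odd ⟨
    s r ∧ parity k          ≡⟨ sum-constant s≡sᵣ ⟨
    sum s                   ≡⟨ rowSum-cliqueStar-centre s (other-outside r) ⟨
    rowSum CS s (other r)   ≡⟨ kernel (other r) (other-outside r) ⟩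
    false                   ∎)
    where
    open ≡-Reasoning
    s≡sᵣ : ∀ j → s j ≡ s r
    s≡sᵣ j with toSum (j ≟F r)
    ... | inj₁ refl = refl
    ... | inj₂ j≢r  = xor≡false⇒≡ (trans (sym (rowSum-cliqueStar-leaf s j≢r (other-outside j)))
                                         (kernel (other j) (other-outside j)))

  rowsDependent-multipartite⇔cliqueStar : LocallyEquivalent K CS → RowsDependent K ⇔ RowsDependent CS
  rowsDependent-multipartite⇔cliqueStar (vs , K~CS) = mk⇔
    (rowsDependent-cong K~CS ∘ to)
    (from ∘ rowsDependent-cong (λ a b → sym (K~CS a b)))
    where open Equivalence (rowsDependent-applyLCs multipartite-symmetric multipartite-loopless vs)

theorem10 : (k : ℕ) → 3 ≤ k → (n : Fin k → ℕ) → (∀ i → 2 ≤ n i) → (r : Fin k) →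
    ¬ LocallyEquivalent (completeMultipartite k n) (cliqueStar k n r)
theorem10 k _ n 2≤n r K~CS with parity k in parity≡
... | true  = cliqueStar-independent-odd parity≡ (to (multipartite-dependent-odd parity≡))
  where open MultipartiteVersusCliqueStar k n 2≤n r
        open Equivalence (rowsDependent-multipartite⇔cliqueStar K~CS)
... | false = multipartite-independent-even parity≡ (from (cliqueStar-dependent-even parity≡))
  where open MultipartiteVersusCliqueStar k n 2≤n r
        open Equivalence (rowsDependent-multipartite⇔cliqueStar K~CS)
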